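{- Let $\underline{D}$ be a double Boolean algebra with $|D_p|>1$. If $\underline{D}$ is sub-directly irreducible, then the subalgebra $\underline{D}_p$ is also sub-directly irreducible.
   Context: A double Boolean algebra (dBa) is an algebra $\underline{D}=(D;\sqcap,\sqcup,\neg,\lrcorner,\bot,\top)$ of type $(2,2,1,1,0,0)$ satisfying, for all $x,y,z$, where $x\vee y:=\neg(\neg x\sqcap\neg y)$ and $x\wedge y:=\lrcorner(\lrcorner x\sqcup\lrcorner y)$: $(x\sqcap x)\sqcap y=x\sqcap y$; $(x\sqcup x)\sqcup y=x\sqcup y$; $\sqcap$ and $\sqcup$ are commutative and associative; $x\sqcap(x\sqcup y)=x\sqcap x$; $x\sqcup(x\sqcap y)=x\sqcup x$; $x\sqcap(x\vee y)=x\sqcap x$; $x\sqcup(x\wedge y)=x\sqcup x$; $x\sqcap(y\vee z)=(x\sqcap y)\vee(x\sqcap z)$; $x\sqcup(y\wedge z)=(x\sqcup y)\wedge(x\sqcup z)$; $\neg\neg(x\sqcap y)=x\sqcap y$; $\lrcorner\lrcorner(x\sqcup y)=x\sqcup y$; $\neg(x\sqcap x)=\neg x$; $\lrcorner(x\sqcup x)=\lrcorner x$; $x\sqcap\neg x=\bot$; $x\sqcup\lrcorner x=\top$; $\neg\bot=\top\sqcap\top$; $\lrcorner\top=\bot\sqcup\bot$; $\neg\top=\bot$; $\lrcorner\bot=\top$; $(x\sqcap x)\sqcup(x\sqcap x)=(x\sqcup x)\sqcap(x\sqcup x)$. $D_p=\{x\in D: x\sqcap x=x\}\cup\{x\in D: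 x\sqcup x=x\}$; it is the universe of a subalgebra $\underline{D}_p=(D_p;\sqcap,\sqcup,\neg,\lrcorner,\bot,\top)$ of $\underline{D}$. Sub-directly irreducible is meant in the sense of universal algebra. -}

module Defs where

open import Level using (Level) renaming (suc to lsuc)
open import Data.Product using (Σ; ∃; _×_; _,_)
open import Data.Sum using (_⊎_)
open import Relation.Binary.PropositionalEquality using (_≡_)
open import Relation.Nullary using (¬_)

record DBA (a : Level) : Set (lsuc a) where
  infixr 7 _⊓_
  infixr 6 _⊔_
  field
    Carrier : Set a
    _⊓_ : Carrier → Carrier → Carrier
    _⊔_ : Carrier → Carrier → Carrier
    ¬ᵈ_ : Carrier → Carrier
    ⌟_ : Carrier → Carrier
    ⊥ᵈ : Carrier
    ⊤ᵈ : Carrier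

  _∨_ : Carrier → Carrier → Carrier
  x ∨ y = ¬ᵈ ((¬ᵈ x) ⊓ (¬ᵈ y))
  _∧_ : Carrier → Carrier → Carrier
  x ∧ y = ⌟ ((⌟ x) ⊔ (⌟ y))

  field
    ax1a : ∀ x y → (x ⊓ x) ⊓ y ≡ x ⊓ y
    ax1b : ∀ x y → (x ⊔ x) ⊔ y ≡ x ⊔ y
    ax2a : ∀ x y → x ⊓ y ≡ y ⊓ x
    ax2b : ∀ x y → x ⊔ y ≡ y ⊔ x
    ax3a : ∀ x y z → x ⊓ (y ⊓ z) ≡ (x ⊓ y) ⊓ z
    ax3b : ∀ x y z → x ⊔ (y ⊔ z) ≡ (x ⊔ y) ⊔ z
    ax4a : ∀ x y → x ⊓ (x ⊔ y) ≡ x ⊓ x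
    ax4b : ∀ x y → x ⊔ (x ⊓ y) ≡ x ⊔ x
    ax5a : ∀ x y → x ⊓ (x ∨ y) ≡ x ⊓ x
    ax5b : ∀ x y → x ⊔ (x ∧ y) ≡ x ⊔ x
    ax6a : ∀ x y z → x ⊓ (y ∨ z) ≡ (x ⊓ y) ∨ (x ⊓ z)
    ax6b : ∀ x y z → x ⊔ (y ∧ z) ≡ (x ⊔ y) ∧ (x ⊔ z)
    ax7a : ∀ x y → ¬ᵈ (¬ᵈ (x ⊓ y)) ≡ x ⊓ y
    ax7b : ∀ x y → ⌟ (⌟ (x ⊔ y)) ≡ x ⊔ y
    ax8a : ∀ x → ¬ᵈ (x ⊓ x) ≡ ¬ᵈ x
    ax8b : ∀ x → ⌟ (x ⊔ x) ≡ ⌟ x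
    ax9a : ∀ x → x ⊓ (¬ᵈ x) ≡ ⊥ᵈ
    ax9b : ∀ x → x ⊔ (⌟ x) ≡ ⊤ᵈ
    ax10a : ¬ᵈ ⊥ᵈ ≡ ⊤ᵈ ⊓ ⊤ᵈ
    ax10b : ⌟ ⊤ᵈ ≡ ⊥ᵈ ⊔ ⊥ᵈ
    ax11a : ¬ᵈ ⊤ᵈ ≡ ⊥ᵈ
    ax11b : ⌟ ⊥ᵈ ≡ ⊤ᵈ
    ax12 : ∀ x → (x ⊓ x) ⊔ (x ⊓ x) ≡ (x ⊔ x) ⊓ (x ⊔ x)

module _ {a : Level} (D : DBA a) where
  open DBA D

  InDp : Carrier → Set a
  InDp x = (x ⊓ x ≡ x) ⊎ (x ⊔ x ≡ x)

  InD : Carrier → Set a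
  InD _ = Carrier

  -- A subalgebra is represented by its universe P (a predicate on D, closed
  -- under the operations); its elements are the x with P x, and two elements
  -- are equal iff they are equal in D.
  record IsCongruenceOn (P : Carrier → Set a) (θ : Carrier → Carrier → Set a) : Set a where
    field
      refl-on  : ∀ {x} → P x → θ x x
      sym-on   : ∀ {x y} → P x → P y → θ x y → θ y x
      trans-on : ∀ {x y z} → P x → P y → P z → θ x y → θ y z → θ x z
      cong-⊓   : ∀ {x x′ y y′} → P x → P x′ → P y → P y′ →
                 θ x x′ → θ y y′ → θ (x ⊓ y) (x′ ⊓ y′)
      cong-⊔   : ∀ {x x′ y y′} → P x → P x′ → P y → P y′ →
                 θ x x′ → θ y y′ → θ (x ⊔ y) (x′ ⊔ y′)
      cong-¬   : ∀ {x x′} → P x → P x′ → θ x x′ → θ (¬ᵈ x) (¬ᵈ x′)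
      cong-⌟   : ∀ {x x′} → P x → P x′ → θ x x′ → θ (⌟ x) (⌟ x′)

  -- Subdirectly irreducible (universal-algebra sense, monolith form,
  -- nontrivial): there are distinct a₀ ≠ b₀ in P such that every congruence
  -- other than the identity congruence Δ identifies a₀ and b₀; i.e. the
  -- intersection of all non-identity congruences is not Δ.
  SubdirectlyIrreducibleOn : (Carrier → Set a) → Set (lsuc a)
  SubdirectlyIrreducibleOn P =
    Σ Carrier λ a₀ → Σ Carrier λ b₀ → P a₀ × P b₀ × ¬ (a₀ ≡ b₀) ×
      (∀ (θ : Carrier → Carrier → Set a) → IsCongruenceOn P θ →
        (Σ Carrier λ x → Σ Carrier λ y → P x × P y × ¬ (x ≡ y) × θ x y) →
        θ a₀ b₀)

  SubdirectlyIrreducible : Set (lsuc a)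
  SubdirectlyIrreducible = SubdirectlyIrreducibleOn InD

  DpSubdirectlyIrreducible : Set (lsuc a)
  DpSubdirectlyIrreducible = SubdirectlyIrreducibleOn InDp

  DpHasTwoElements : Set a
  DpHasTwoElements = Σ Carrier λ x → Σ Carrier λ y → InDp x × InDp y × ¬ (x ≡ y)

-- Every congruence θ of D_p extends to the congruence "θ or equal" of D: this
-- is compatible with the operations because x ⊓ z = x ⊓ (z ⊓ z), ¬ x, and
-- their duals always land in D_p.  A non-identity θ therefore gives a
-- non-identity congruence of D, which identifies the monolith pair (a₀, b₀)
-- of D; since a₀ ≠ b₀, this can only happen inside θ.  Applied to the total
-- relation on D_p (non-identity because |D_p| > 1) this also shows that
-- a₀ and b₀ lie in D_p, so they form a monolith pair of D_p.
module Submission where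

open import Defs
open import Level using (Level)
open import Data.Product using (Σ; _×_; _,_; proj₂)
open import Data.Sum using (_⊎_; inj₁; inj₂)
open import Data.Empty using (⊥-elim)
open import Relation.Binary.Core using (Rel)
open import Relation.Binary.Construct.Always using (Always)
open import Relation.Binary.PropositionalEquality
  using (_≡_; _≢_; refl; sym; trans; cong; subst₂; module ≡-Reasoning)

dual : ∀ {a} → DBA a → DBA a
dual D = record
  { Carrier = Carrier ; _⊓_ = _⊔_ ; _⊔_ = _⊓_ ; ¬ᵈ_ = ⌟_ ; ⌟_ = ¬ᵈ_ ; ⊥ᵈ = ⊤ᵈ ; ⊤ᵈ = ⊥ᵈ
  ; ax1a = ax1b ; ax1b = ax1a ; ax2a = ax2b ; ax2b = ax2a ; ax3a = ax3b ; ax3b = ax3a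
  ; ax4a = ax4b ; ax4b = ax4a ; ax5a = ax5b ; ax5b = ax5a ; ax6a = ax6b ; ax6b = ax6a
  ; ax7a = ax7b ; ax7b = ax7a ; ax8a = ax8b ; ax8b = ax8a ; ax9a = ax9b ; ax9b = ax9a
  ; ax10a = ax10b ; ax10b = ax10a ; ax11a = ax11b ; ax11b = ax11a
  ; ax12 = λ x → sym (ax12 x)
  }
  where open DBA D

module MeetProperties {a} (D : DBA a) where
  open DBA D
  open ≡-Reasoning

  ⊓-squareʳ : ∀ x z → x ⊓ (z ⊓ z) ≡ x ⊓ z
  ⊓-squareʳ x z = begin
    x ⊓ (z ⊓ z) ≡⟨ ax2a x (z ⊓ z) ⟩
    (z ⊓ z) ⊓ x ≡⟨ ax1a z x ⟩
    z ⊓ x       ≡⟨ ax2a z x ⟩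
    x ⊓ z       ∎

  ⊓-idem-on-⊓ : ∀ x z → (x ⊓ z) ⊓ (x ⊓ z) ≡ x ⊓ z
  ⊓-idem-on-⊓ x z = begin
    (x ⊓ z) ⊓ (x ⊓ z) ≡⟨ ax3a (x ⊓ z) x z ⟩
    ((x ⊓ z) ⊓ x) ⊓ z ≡⟨ cong (_⊓ z) (ax2a (x ⊓ z) x) ⟩
    (x ⊓ (x ⊓ z)) ⊓ z ≡⟨ cong (_⊓ z) (ax3a x x z) ⟩
    ((x ⊓ x) ⊓ z) ⊓ z ≡⟨ cong (_⊓ z) (ax1a x z) ⟩
    (x ⊓ z) ⊓ z       ≡⟨ sym (ax3a x z z) ⟩
    x ⊓ (z ⊓ z)       ≡⟨ ⊓-squareʳ x z ⟩
    x ⊓ z             ∎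

  ¬¬-square : ∀ x → ¬ᵈ ¬ᵈ x ≡ x ⊓ x
  ¬¬-square x = trans (cong ¬ᵈ_ (sym (ax8a x))) (ax7a x x)

  ⊓-idem-on-¬ : ∀ x → ¬ᵈ x ⊓ ¬ᵈ x ≡ ¬ᵈ x
  ⊓-idem-on-¬ x = begin
    ¬ᵈ x ⊓ ¬ᵈ x    ≡⟨ sym (¬¬-square (¬ᵈ x)) ⟩
    ¬ᵈ ¬ᵈ ¬ᵈ x     ≡⟨ cong ¬ᵈ_ (¬¬-square x) ⟩
    ¬ᵈ (x ⊓ x)     ≡⟨ ax8a x ⟩
    ¬ᵈ x           ∎

module DpClosure {a} (D : DBA a) where
  open DBA D
  open MeetProperties D public using (⊓-squareʳ)
  open MeetProperties (dual D) public using () renaming (⊓-squareʳ to ⊔-squareʳ)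

  ⊓-∈Dp : ∀ x z → InDp D (x ⊓ z)
  ⊓-∈Dp x z = inj₁ (MeetProperties.⊓-idem-on-⊓ D x z)

  ⊔-∈Dp : ∀ x z → InDp D (x ⊔ z)
  ⊔-∈Dp x z = inj₂ (MeetProperties.⊓-idem-on-⊓ (dual D) x z)

  ¬-∈Dp : ∀ x → InDp D (¬ᵈ x)
  ¬-∈Dp x = inj₁ (MeetProperties.⊓-idem-on-¬ D x)

  ⌟-∈Dp : ∀ x → InDp D (⌟ x)
  ⌟-∈Dp x = inj₂ (MeetProperties.⊓-idem-on-¬ (dual D) x)

module Extension {a} {D : DBA a} where
  open DBA D
  open DpClosure D

  extension : Rel Carrier a → Rel Carrier a
  extension θ x y = x ≡ y ⊎ (InDp D x × InDp D y × θ x y)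

  extension-distinct : ∀ {θ x y} → x ≢ y → extension θ x y → InDp D x × InDp D y × θ x y
  extension-distinct x≢y (inj₁ x≡y) = ⊥-elim (x≢y x≡y)
  extension-distinct x≢y (inj₂ related) = related

  module _ {θ : Rel Carrier a} (isCong : IsCongruenceOn D (InDp D) θ) where
    open IsCongruenceOn isCong

    private
      Ψ = extension θ

      Ψ-sym : ∀ {x y} → Ψ x y → Ψ y x
      Ψ-sym (inj₁ refl) = inj₁ refl
      Ψ-sym (inj₂ (x∈ , y∈ , xθy)) = inj₂ (y∈ , x∈ , sym-on x∈ y∈ xθy)

      Ψ-trans : ∀ {x y z} → Ψ x y → Ψ y z → Ψ x z
      Ψ-trans (inj₁ refl) yΨz = yΨz
      Ψ-trans xΨy (inj₁ refl) = xΨy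
      Ψ-trans (inj₂ (x∈ , y∈ , xθy)) (inj₂ (_ , z∈ , yθz)) =
        inj₂ (x∈ , z∈ , trans-on x∈ y∈ z∈ xθy yθz)

      Ψ-cong₁ : ∀ (f : Carrier → Carrier) → (∀ x → InDp D (f x)) →
                (∀ {x x′} → InDp D x → InDp D x′ → θ x x′ → θ (f x) (f x′)) →
                ∀ {x x′} → Ψ x x′ → Ψ (f x) (f x′)
      Ψ-cong₁ f f∈ θ-cong (inj₁ refl) = inj₁ refl
      Ψ-cong₁ f f∈ θ-cong (inj₂ (x∈ , x′∈ , xθx′)) =
        inj₂ (f∈ _ , f∈ _ , θ-cong x∈ x′∈ xθx′)

      -- z need not lie in D_p, so θ is applied to z ∙ z instead, which does.
      Ψ-congˡ : ∀ (_∙_ : Carrier → Carrier → Carrier) →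
                (∀ x z → InDp D (x ∙ z)) → (∀ x z → x ∙ (z ∙ z) ≡ x ∙ z) →
                (∀ {x x′ y y′} → InDp D x → InDp D x′ → InDp D y → InDp D y′ →
                   θ x x′ → θ y y′ → θ (x ∙ y) (x′ ∙ y′)) →
                ∀ {x x′} z → Ψ x x′ → Ψ (x ∙ z) (x′ ∙ z)
      Ψ-congˡ _∙_ ∙∈ square θ-cong z (inj₁ refl) = inj₁ refl
      Ψ-congˡ _∙_ ∙∈ square θ-cong {x} {x′} z (inj₂ (x∈ , x′∈ , xθx′)) =
        inj₂ (∙∈ x z , ∙∈ x′ z ,
              subst₂ θ (square x z) (square x′ z)
                (θ-cong x∈ x′∈ zz∈ zz∈ xθx′ (refl-on zz∈)))
        where zz∈ = ∙∈ z z

      Ψ-cong₂ : ∀ (_∙_ : Carrier → Carrier → Carrier) → (∀ x y → x ∙ y ≡ y ∙ x) →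
                (∀ x z → InDp D (x ∙ z)) → (∀ x z → x ∙ (z ∙ z) ≡ x ∙ z) →
                (∀ {x x′ y y′} → InDp D x → InDp D x′ → InDp D y → InDp D y′ →
                   θ x x′ → θ y y′ → θ (x ∙ y) (x′ ∙ y′)) →
                ∀ {x x′ y y′} → Ψ x x′ → Ψ y y′ → Ψ (x ∙ y) (x′ ∙ y′)
      Ψ-cong₂ _∙_ comm ∙∈ square θ-cong {x} {x′} {y} {y′} xΨx′ yΨy′ =
        Ψ-trans (Ψ-congˡ _∙_ ∙∈ square θ-cong y xΨx′)
                (subst₂ Ψ (comm y x′) (comm y′ x′) (Ψ-congˡ _∙_ ∙∈ square θ-cong x′ yΨy′))

    extension-isCongruence : IsCongruenceOn D (InD D) (extension θ)
    extension-isCongruence = record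
      { refl-on  = λ _ → inj₁ refl
      ; sym-on   = λ _ _ → Ψ-sym
      ; trans-on = λ _ _ _ → Ψ-trans
      ; cong-⊓   = λ _ _ _ _ → Ψ-cong₂ _⊓_ ax2a ⊓-∈Dp ⊓-squareʳ cong-⊓
      ; cong-⊔   = λ _ _ _ _ → Ψ-cong₂ _⊔_ ax2b ⊔-∈Dp ⊔-squareʳ cong-⊔
      ; cong-¬   = λ _ _ → Ψ-cong₁ ¬ᵈ_ ¬-∈Dp cong-¬
      ; cong-⌟   = λ _ _ → Ψ-cong₁ ⌟_ ⌟-∈Dp cong-⌟
      }

  NonIdentityOn : (Carrier → Set a) → Rel Carrier a → Set a
  NonIdentityOn P θ = Σ Carrier λ u → Σ Carrier λ v → P u × P v × u ≢ v × θ u v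

  restrict-monolith : ∀ {a₀ b₀} → a₀ ≢ b₀ →
    (∀ ψ → IsCongruenceOn D (InD D) ψ → NonIdentityOn (InD D) ψ → ψ a₀ b₀) →
    ∀ θ → IsCongruenceOn D (InDp D) θ → NonIdentityOn (InDp D) θ →
    InDp D a₀ × InDp D b₀ × θ a₀ b₀
  restrict-monolith a₀≢b₀ least θ isCong (u , v , u∈ , v∈ , u≢v , uθv) =
    extension-distinct {θ = θ} a₀≢b₀
      (least (extension θ) (extension-isCongruence isCong) (u , v , u , v , u≢v , inj₂ (u∈ , v∈ , uθv)))

open Extension

always-isCongruence : ∀ {a} (D : DBA a) → IsCongruenceOn D (InDp D) Always
always-isCongruence D = record {}

lemma4p6 : ∀ {a : Level} (D : DBA a) → DpHasTwoElements D →
    SubdirectlyIrreducible D → DpSubdirectlyIrreducible D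
lemma4p6 D (x , y , x∈ , y∈ , x≢y) (a₀ , b₀ , _ , _ , a₀≢b₀ , least)
  with restrict-monolith a₀≢b₀ least Always (always-isCongruence D) (x , y , x∈ , y∈ , x≢y , _)
... | a₀∈ , b₀∈ , _ =
  a₀ , b₀ , a₀∈ , b₀∈ , a₀≢b₀ ,
  λ θ isCong nonIdentity → proj₂ (proj₂ (restrict-monolith a₀≢b₀ least θ isCong nonIdentity))
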